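{- Let $n\ge 1$, $1\le m\le n$ and $0\le t\le m-1$ be integers and consider the flag-shaped minimum blocker $B_n(m,t)$ of all $n\times n$ $123$-avoiding permutation matrices. Then the face of $\Omega_n(\overline{123})$ determined by $B_n(m,t)$ has dimension at most $(n-1)^2+1-t(n-m)$; that is, the maximum number of linearly independent (as real $n\times n$ matrices) $n\times n$ $123$-avoiding permutation matrices each of which has exactly one $1$ in a position of $B_n(m,t)$ is at most $(n-1)^2+1-t(n-m)$.
   Context: A permutation matrix $P$ contains a $123$-pattern if $I_3$ is a submatrix of $P$; otherwise $P$ is $123$-avoiding. $\Omega_n(\overline{123})$ denotes the polytope (convex hull) of the $n\times n$ $123$-avoiding permutation matrices. A set of positions is a blocker if every $n\times n$ $123$-avoiding permutation matrix has a $1$ in one of its positions, and it is minimum if removing any element makes it no longer a blocker. In this paper, the dimension of the face of $\Omega_n(\overline{123})$ determined by a minimum blocker $Q$ is taken to be the maximum number of linearly independent $123$-avoiding permutation matrices that intersect $Q$ exactly once (have exactly one $1$ in a position of $Q$). For integers $1\le m\le n$, $0\le t\le m-1$, the flag-shaped blocker $B_n(m,t)$ is the union of $\{(i,m): 1\le i\le n-t\}$ and $\{(i,j): 1\le i\le n-m+1,\ m-t\le j\le m-1\}$, positions written as (row, column). -}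

module Defs where

open import Data.Nat using (ℕ; zero; suc; _+_; _*_; _∸_; _≤_; _<_; _≡ᵇ_; _≤ᵇ_)
open import Data.Bool using (Bool; true; false; if_then_else_; _∧_; _∨_)
open import Data.Fin using (Fin; toℕ; _≟_)
import Data.Fin as F
open import Data.Fin.Permutation using (Permutation′; _⟨$⟩ʳ_)
open import Data.Rational using (ℚ; 0ℚ; 1ℚ) renaming (_+_ to _+ℚ_; _*_ to _*ℚ_)
open import Data.Product using (Σ; _×_; ∃-syntax)
open import Data.List using (List; map; allFin)
open import Data.Nat.ListAction using (sum)
open import Relation.Nullary using (¬_; does)
open import Relation.Binary.PropositionalEquality using (_≡_)

-- n×n matrices with rational entries; rows and columns indexed 0..n-1
-- (row r, column c here corresponds to (r+1, c+1) in the paper's 1-indexing).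
Matrix : ℕ → Set
Matrix n = Fin n → Fin n → ℚ

permMatrix : ∀ {n} → Permutation′ n → Matrix n
permMatrix σ r c = if does ((σ ⟨$⟩ʳ r) ≟ c) then 1ℚ else 0ℚ

I₃ : Fin 3 → Fin 3 → ℚ
I₃ a b = if does (a ≟ b) then 1ℚ else 0ℚ

StrictlyIncreasing : ∀ {n} → (Fin 3 → Fin n) → Set
StrictlyIncreasing f = ∀ (a b : Fin 3) → a F.< b → f a F.< f b

Contains123 : ∀ {n} → Matrix n → Set
Contains123 {n} P =
  Σ (Fin 3 → Fin n) λ rows → Σ (Fin 3 → Fin n) λ cols →
    StrictlyIncreasing rows × StrictlyIncreasing cols ×
    (∀ a b → P (rows a) (cols b) ≡ I₃ a b)

Avoids123 : ∀ {n} → Permutation′ n → Set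
Avoids123 σ = ¬ Contains123 (permMatrix σ)

inB : (n m t : ℕ) → Fin n → Fin n → Bool
inB n m t r c =
  let i = suc (toℕ r) ; j = suc (toℕ c) in
  ((j ≡ᵇ m) ∧ (i ≤ᵇ n ∸ t))
  ∨ ((i ≤ᵇ (n + 1) ∸ m) ∧ ((m ∸ t) ≤ᵇ j) ∧ (j ≤ᵇ m ∸ 1))

hitsB : (n m t : ℕ) → Permutation′ n → ℕ
hitsB n m t σ = sum (map (λ r → if inB n m t r (σ ⟨$⟩ʳ r) then 1 else 0) (allFin n))

sumℚ : ∀ {k} → (Fin k → ℚ) → ℚ
sumℚ {zero} f = 0ℚ
sumℚ {suc k} f = f F.zero +ℚ sumℚ (λ l → f (F.suc l))

LinearlyIndependent : ∀ {n k} → (Fin k → Matrix n) → Set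
LinearlyIndependent {n} {k} M =
  ∀ (coef : Fin k → ℚ) →
    (∀ (r c : Fin n) → sumℚ (λ l → coef l *ℚ M l r c) ≡ 0ℚ) →
    ∀ l → coef l ≡ 0ℚ

{-# OPTIONS --safe #-}
module Submission where

-- A 123-avoiding permutation matrix with exactly one 1 in B_n(m,t) has no 1 in the south-east
-- corner formed by the last t rows and the last n-m columns: of the t+1 ones in the flag columns
-- m-t, …, m at least t are missed by B_n(m,t), and these cannot be placed without either a 123
-- pattern or too many ones in the last m-1 rows.  A matrix in the span of the permutation
-- matrices is determined by its common line sum and its lower-right (n-1)×(n-1) block, which
-- contains that corner.  So independent such matrices give independent vectors in a space of
-- dimension 1 + (n-1)² - t(n-m).

open import Defs
open import Data.Nat using (ℕ; zero; suc; _≤_; z≤n; s≤s)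
open import Data.Fin using (Fin; zero; suc; toℕ; punchIn; punchOut)
import Data.Fin as Fin
import Data.Fin.Properties as Fin
open import Data.Fin.Permutation using (Permutation′; _⟨$⟩ʳ_; _⟨$⟩ˡ_; inverseˡ; inverseʳ)
open import Data.Maybe using (Maybe; nothing; just)
open import Data.Product using (_×_; _,_; ∃-syntax; map; map₁)
open import Data.Sum using (_⊎_; inj₁; inj₂; [_,_]′)
open import Data.Empty using (⊥; ⊥-elim)
open import Function using (_∘_; id)
open import Relation.Nullary using (Dec; yes; no; does; ¬_)
open import Relation.Nullary.Decidable using (_×-dec_; _⊎-dec_; ¬?; dec-true; dec-false; decidable-stable)
open import Relation.Binary.PropositionalEquality

module Independence where
  open import Data.Rational using (ℚ; 0ℚ; 1ℚ; 1/_; _+_; _-_; _*_; -_; NonZero; ≢-nonZero)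
  open import Data.Rational.Properties
    using (_≟_; +-*-commutativeRing; *-zeroˡ; *-zeroʳ; *-identityˡ; *-identityʳ; *-inverseˡ; 1≢0; +-inverseʳ)
  open import Algebra.Bundles using (CommutativeRing)
  open import Data.Rational.Solver using (module +-*-Solver)
  open import Algebra.Properties.Semiring.Sum (CommutativeRing.semiring +-*-commutativeRing)
    using (sum; sum-cong-≗; ∑-distrib-+; *-distribʳ-sum; sum-replicate-zero)
  open +-*-Solver using (solve; _:+_; _:*_; _:-_; :-_; _:=_)
  open ≡-Reasoning

  Independent : ∀ {k} {I : Set} → (Fin k → I → ℚ) → Set
  Independent {k} {I} v =
    ∀ (c : Fin k → ℚ) → (∀ x → sum (λ l → c l * v l x) ≡ 0ℚ) → ∀ l → c l ≡ 0ℚ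

  independent-restrict : ∀ {k} {I J : Set} (v : Fin k → I → ℚ) (e : J → I) →
    (∀ x → (∀ l → v l x ≡ 0ℚ) ⊎ ∃[ y ] e y ≡ x) →
    Independent v → Independent (λ l y → v l (e y))
  independent-restrict {k} v e covers independent c restricted = independent c everywhere
    where
    everywhere : ∀ x → sum (λ l → c l * v l x) ≡ 0ℚ
    everywhere x with covers x
    ... | inj₁ vanishes = trans (sum-cong-≗ λ l → trans (cong (c l *_) (vanishes l)) (*-zeroʳ (c l)))
                                (sum-replicate-zero k)
    ... | inj₂ (y , refl) = restricted y

  independent⇒head≢0 : ∀ {k} {I : Set} (v : Fin (suc k) → I → ℚ) → Independent v →
    ¬ (∀ x → v zero x ≡ 0ℚ)
  independent⇒head≢0 {k} v independent v₀≡0 = 1≢0 (independent c combination zero)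
    where
    c : Fin (suc k) → ℚ
    c zero = 1ℚ
    c (suc _) = 0ℚ
    combination : ∀ x → sum (λ l → c l * v l x) ≡ 0ℚ
    combination x = cong₂ _+_ (trans (*-identityˡ _) (v₀≡0 x))
                              (trans (sum-cong-≗ λ l → *-zeroˡ (v (suc l) x)) (sum-replicate-zero k))

  eliminate : ∀ {k} {I : Set} (v : Fin (suc k) → I → ℚ) (x₀ : I) .{{_ : NonZero (v zero x₀)}} →
    Fin k → I → ℚ
  eliminate v x₀ l x = v (suc l) x - (v (suc l) x₀ * 1/ v zero x₀) * v zero x

  eliminate-pivot : ∀ {k} {I : Set} (v : Fin (suc k) → I → ℚ) (x₀ : I)
    .{{_ : NonZero (v zero x₀)}} → ∀ l → eliminate v x₀ l x₀ ≡ 0ℚ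
  eliminate-pivot v x₀ l = begin
    a - (a * 1/ p) * p   ≡⟨ solve 3 (λ a q p → a :- (a :* q) :* p := a :- a :* (q :* p)) refl a (1/ p) p ⟩
    a - a * (1/ p * p)   ≡⟨ cong (λ z → a - a * z) (*-inverseˡ p) ⟩
    a - a * 1ℚ           ≡⟨ cong (λ z → a - z) (*-identityʳ a) ⟩
    a - a                ≡⟨ +-inverseʳ a ⟩
    0ℚ                   ∎
    where
    a = v (suc l) x₀
    p = v zero x₀

  independent-eliminate : ∀ {k} {I : Set} (v : Fin (suc k) → I → ℚ) (x₀ : I)
    .{{_ : NonZero (v zero x₀)}} → Independent v → Independent (eliminate v x₀)
  independent-eliminate {k} v x₀ independent c′ eliminated l = independent c combination (suc l)
    where
    r : Fin k → ℚ
    r l = v (suc l) x₀ * 1/ v zero x₀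
    c : Fin (suc k) → ℚ
    c zero = sum (λ l → - (c′ l * r l))
    c (suc l) = c′ l
    combination : ∀ x → sum (λ l → c l * v l x) ≡ 0ℚ
    combination x = begin
      c zero * b + sum (λ l → c′ l * a l)
        ≡⟨ cong (_+ sum (λ l → c′ l * a l)) (*-distribʳ-sum b (λ l → - (c′ l * r l))) ⟩
      sum (λ l → - (c′ l * r l) * b) + sum (λ l → c′ l * a l)
        ≡⟨ ∑-distrib-+ (λ l → - (c′ l * r l) * b) _ ⟨
      sum (λ l → - (c′ l * r l) * b + c′ l * a l)
        ≡⟨ sum-cong-≗ (λ l → regroup (c′ l) (r l) (a l) b) ⟩
      sum (λ l → c′ l * eliminate v x₀ l x)
        ≡⟨ eliminated x ⟩
      0ℚ ∎
      where
      a : Fin k → ℚ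
      a l = v (suc l) x
      b = v zero x
      regroup : ∀ γ ρ α β → - (γ * ρ) * β + γ * α ≡ γ * (α - ρ * β)
      regroup = solve 4 (λ γ ρ α β → (:- (γ :* ρ)) :* β :+ γ :* α := γ :* (α :- ρ :* β)) refl

  independent⇒≤ : ∀ {k d} (v : Fin k → Fin d → ℚ) → Independent v → k ≤ d
  independent⇒≤ {zero} v _ = z≤n
  independent⇒≤ {suc k} {zero} v independent = ⊥-elim (independent⇒head≢0 v independent (λ ()))
  independent⇒≤ {suc k} {suc d} v independent with Fin.any? (λ x → ¬? (v zero x ≟ 0ℚ))
  ... | no noPivot = ⊥-elim (independent⇒head≢0 v independent λ x →
          decidable-stable (v zero x ≟ 0ℚ) (λ v₀x≢0 → noPivot (x , v₀x≢0)))
  ... | yes (x₀ , v₀x₀≢0) = s≤s (independent⇒≤ _ (independent-restrict _ (punchIn x₀) offPivot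
          (independent-eliminate v x₀ independent)))
    where
    instance _ = ≢-nonZero v₀x₀≢0
    offPivot : ∀ x → (∀ l → eliminate v x₀ l x ≡ 0ℚ) ⊎ ∃[ y ] punchIn x₀ y ≡ x
    offPivot x with x₀ Fin.≟ x
    ... | yes refl = inj₁ (eliminate-pivot v x₀)
    ... | no x₀≢x = inj₂ (punchOut x₀≢x , Fin.punchIn-punchOut x₀≢x)

module PermutationMatrices where
  open Independence
  open import Data.Rational using (ℚ; 0ℚ; 1ℚ; _+_; _*_)
  open import Data.Rational.Properties using (+-*-commutativeRing; +-identityʳ; *-identityʳ)
  open import Algebra.Bundles using (CommutativeRing)
  open import Algebra.Properties.Semiring.Sum (CommutativeRing.semiring +-*-commutativeRing)
    using (sum; sum-cong-≗; sum-remove; sum-replicate-zero; ∑-comm; *-distribˡ-sum)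
  open ≡-Reasoning

  sumℚ≡sum : ∀ {k} (f : Fin k → ℚ) → sumℚ f ≡ sum f
  sumℚ≡sum {zero} f = refl
  sumℚ≡sum {suc k} f = cong (f zero +_) (sumℚ≡sum (f ∘ suc))

  sum-single : ∀ {n} (f : Fin n → ℚ) (j : Fin n) → (∀ i → i ≢ j → f i ≡ 0ℚ) → sum f ≡ f j
  sum-single {suc n} f j off = begin
    sum f                        ≡⟨ sum-remove f ⟩
    f j + sum (f ∘ punchIn j)    ≡⟨ cong (f j +_) (sum-cong-≗ {n} (λ i → off _ (Fin.punchInᵢ≢i j i))) ⟩
    f j + sum {n} (λ _ → 0ℚ)     ≡⟨ cong (f j +_) (sum-replicate-zero n) ⟩
    f j + 0ℚ                     ≡⟨ +-identityʳ (f j) ⟩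
    f j                          ∎

  permMatrix-one : ∀ {n} (σ : Permutation′ n) {r c} → σ ⟨$⟩ʳ r ≡ c → permMatrix σ r c ≡ 1ℚ
  permMatrix-one σ {r} {c} σr≡c with σ ⟨$⟩ʳ r Fin.≟ c
  ... | yes _ = refl
  ... | no σr≢c = ⊥-elim (σr≢c σr≡c)

  permMatrix-zero : ∀ {n} (σ : Permutation′ n) {r c} → σ ⟨$⟩ʳ r ≢ c → permMatrix σ r c ≡ 0ℚ
  permMatrix-zero σ {r} {c} σr≢c with σ ⟨$⟩ʳ r Fin.≟ c
  ... | yes σr≡c = ⊥-elim (σr≢c σr≡c)
  ... | no _ = refl

  permMatrix-rowSum : ∀ {n} (σ : Permutation′ n) r → sum (permMatrix σ r) ≡ 1ℚ
  permMatrix-rowSum σ r =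
    trans (sum-single _ (σ ⟨$⟩ʳ r) (λ c c≢σr → permMatrix-zero σ (c≢σr ∘ sym))) (permMatrix-one σ refl)

  permMatrix-columnSum : ∀ {n} (σ : Permutation′ n) c → sum (λ r → permMatrix σ r c) ≡ 1ℚ
  permMatrix-columnSum σ c =
    trans (sum-single _ (σ ⟨$⟩ˡ c) (λ r r≢σ⁻¹c → permMatrix-zero σ (λ σr≡c →
             r≢σ⁻¹c (trans (sym (inverseˡ σ)) (cong (σ ⟨$⟩ˡ_) σr≡c)))))
          (permMatrix-one σ (inverseʳ σ))

  module _ {n k} (c : Fin k → ℚ) (σ : Fin k → Permutation′ n) where

    combination : Matrix n
    combination r col = sum (λ l → c l * permMatrix (σ l) r col)

    combination-rowSum : ∀ r → sum (combination r) ≡ sum c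
    combination-rowSum r = begin
      sum (λ col → sum (λ l → c l * permMatrix (σ l) r col))
        ≡⟨ ∑-comm (λ col l → c l * permMatrix (σ l) r col) ⟩
      sum (λ l → sum (λ col → c l * permMatrix (σ l) r col))
        ≡⟨ sum-cong-≗ (λ l → *-distribˡ-sum (c l) (permMatrix (σ l) r)) ⟨
      sum (λ l → c l * sum (permMatrix (σ l) r))
        ≡⟨ sum-cong-≗ (λ l → trans (cong (c l *_) (permMatrix-rowSum (σ l) r)) (*-identityʳ (c l))) ⟩
      sum c ∎

    combination-columnSum : ∀ col → sum (λ r → combination r col) ≡ sum c
    combination-columnSum col = begin
      sum (λ r → sum (λ l → c l * permMatrix (σ l) r col))
        ≡⟨ ∑-comm (λ r l → c l * permMatrix (σ l) r col) ⟩
      sum (λ l → sum (λ r → c l * permMatrix (σ l) r col))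
        ≡⟨ sum-cong-≗ (λ l → *-distribˡ-sum (c l) (λ r → permMatrix (σ l) r col)) ⟨
      sum (λ l → c l * sum (λ r → permMatrix (σ l) r col))
        ≡⟨ sum-cong-≗ (λ l → trans (cong (c l *_) (permMatrix-columnSum (σ l) col)) (*-identityʳ (c l))) ⟩
      sum c ∎

  lineSums≡0∧block≡0⇒≡0 : ∀ {n} (A : Matrix (suc n)) →
    (∀ r → sum (A r) ≡ 0ℚ) → (∀ c → sum (λ r → A r c) ≡ 0ℚ) →
    (∀ r c → A (suc r) (suc c) ≡ 0ℚ) → ∀ r c → A r c ≡ 0ℚ
  lineSums≡0∧block≡0⇒≡0 A rows columns block = entry
    where
    sum-head : ∀ {m} (f : Fin (suc m) → ℚ) → (∀ i → f (suc i) ≡ 0ℚ) → sum f ≡ f zero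
    sum-head f tail≡0 = sum-single f zero λ { zero 0≢0 → ⊥-elim (0≢0 refl) ; (suc i) _ → tail≡0 i }
    firstRow : ∀ c → A zero (suc c) ≡ 0ℚ
    firstRow c = trans (sym (sum-head (λ r → A r (suc c)) (λ r → block r c))) (columns (suc c))
    firstColumn : ∀ r → A (suc r) zero ≡ 0ℚ
    firstColumn r = trans (sym (sum-head (A (suc r)) (block r))) (rows (suc r))
    entry : ∀ r c → A r c ≡ 0ℚ
    entry zero zero = trans (sym (sum-head (A zero) firstRow)) (rows zero)
    entry zero (suc c) = firstRow c
    entry (suc r) zero = firstColumn r
    entry (suc r) (suc c) = block r c

  -- The coordinate nothing stands for the common row and column sum, which is 1 for every
  -- permutation matrix; just (r , c) is the entry in row r + 1 and column c + 1.
  lineSumAndBlock : ∀ {n} → Permutation′ (suc n) → Maybe (Fin n × Fin n) → ℚ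
  lineSumAndBlock σ nothing = 1ℚ
  lineSumAndBlock σ (just (r , c)) = permMatrix σ (suc r) (suc c)

  independent-lineSumAndBlock : ∀ {n k} (σ : Fin k → Permutation′ (suc n)) →
    LinearlyIndependent (λ l → permMatrix (σ l)) → Independent (λ l → lineSumAndBlock (σ l))
  independent-lineSumAndBlock {n} {k} σ independent c coordinates≡0 =
    independent c (λ r col → trans (sumℚ≡sum (λ l → c l * permMatrix (σ l) r col)) (vanishes r col))
    where
    total≡0 : sum c ≡ 0ℚ
    total≡0 = trans (sum-cong-≗ (λ l → sym (*-identityʳ (c l)))) (coordinates≡0 nothing)
    vanishes : ∀ r col → combination c σ r col ≡ 0ℚ
    vanishes = lineSums≡0∧block≡0⇒≡0 (combination c σ)
      (λ r → trans (combination-rowSum c σ r) total≡0)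
      (λ col → trans (combination-columnSum c σ col) total≡0)
      (λ r col → coordinates≡0 (just (r , col)))

open import Data.Nat using (_+_; _*_; _∸_; _^_; _<_; s≤s⁻¹; _≤ᵇ_)
open import Data.Nat.Properties
open import Data.Nat.Tactic.RingSolver using (solve-∀)
import Data.Nat.ListAction as List
open import Data.Fin using (fromℕ<; inject≤; splitAt; remQuot; combine; _↑ˡ_; _↑ʳ_)
open import Data.Vec.Functional using (_∷_; [])
open import Data.Bool using (T; if_then_else_)
open import Data.Bool.Properties using (T-∧; T-∨)
open import Data.List using (tabulate)
open import Data.List.Properties using (map-tabulate)
open import Data.Rational using (0ℚ)
open import Function.Bundles using (Equivalence)
open import Level using (0ℓ)
open import Relation.Nullary.Decidable.Core using (T?)
open import Relation.Unary using (Pred; Decidable; _⊆_)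
open import Relation.Unary.Properties using (_∪?_)
open import Relation.Binary.Definitions using (tri<; tri≈; tri>)

module Counting where
  open import Algebra.Properties.CommutativeMonoid.Sum +-0-commutativeMonoid
    using (sum; sum-cong-≗; ∑-distrib-+; sum-permute)

  listSum-tabulate : ∀ {k} (f : Fin k → ℕ) → List.sum (tabulate f) ≡ sum f
  listSum-tabulate {zero} f = refl
  listSum-tabulate {suc k} f = cong (f zero +_) (listSum-tabulate (f ∘ suc))

  count : ∀ {n ℓ} {P : Pred (Fin n) ℓ} → Decidable P → ℕ
  count P? = sum (λ i → if does (P? i) then 1 else 0)

  count-mono : ∀ {n ℓ} {P Q : Pred (Fin n) ℓ} (P? : Decidable P) (Q? : Decidable Q) →
    P ⊆ Q → count P? ≤ count Q?
  count-mono {P = P} {Q = Q} P? Q? P⊆Q = sum-mono (λ i → indicator-mono (P? i) (Q? i))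
    where
    sum-mono : ∀ {k} {f g : Fin k → ℕ} → (∀ i → f i ≤ g i) → sum f ≤ sum g
    sum-mono {zero} _ = z≤n
    sum-mono {suc k} f≤g = +-mono-≤ (f≤g zero) (sum-mono (f≤g ∘ suc))
    indicator-mono : ∀ {i} (p : Dec (P i)) (q : Dec (Q i)) →
      (if does p then 1 else 0) ≤ (if does q then 1 else 0)
    indicator-mono (yes _) (yes _) = ≤-refl
    indicator-mono (yes p) (no ¬q) = ⊥-elim (¬q (P⊆Q p))
    indicator-mono (no _) _ = z≤n

  count-cong : ∀ {n ℓ} {P Q : Pred (Fin n) ℓ} (P? : Decidable P) (Q? : Decidable Q) →
    P ⊆ Q → Q ⊆ P → count P? ≡ count Q?
  count-cong P? Q? P⊆Q Q⊆P = ≤-antisym (count-mono P? Q? P⊆Q) (count-mono Q? P? Q⊆P)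

  count-∪ : ∀ {n ℓ} {P Q : Pred (Fin n) ℓ} (P? : Decidable P) (Q? : Decidable Q) →
    (∀ {i} → P i → ¬ Q i) → count (P? ∪? Q?) ≡ count P? + count Q?
  count-∪ {P = P} {Q = Q} P? Q? disjoint =
    trans (sum-cong-≗ (λ i → indicator-∪ (P? i) (Q? i)))
          (∑-distrib-+ (λ i → if does (P? i) then 1 else 0) (λ i → if does (Q? i) then 1 else 0))
    where
    indicator-∪ : ∀ {i} (p : Dec (P i)) (q : Dec (Q i)) →
      (if does (p ⊎-dec q) then 1 else 0) ≡ (if does p then 1 else 0) + (if does q then 1 else 0)
    indicator-∪ (yes p) (yes q) = ⊥-elim (disjoint p q)
    indicator-∪ (yes _) (no _) = refl
    indicator-∪ (no _) (yes _) = refl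
    indicator-∪ (no _) (no _) = refl

  count-permute : ∀ {n ℓ} {P : Pred (Fin n) ℓ} (P? : Decidable P) (σ : Permutation′ n) →
    count (λ i → P? (σ ⟨$⟩ʳ i)) ≡ count P?
  count-permute P? σ = sym (sum-permute _ σ)

  count-∅ : ∀ {n ℓ} {P : Pred (Fin n) ℓ} (P? : Decidable P) → (∀ i → ¬ P i) → count P? ≡ 0
  count-∅ {zero} P? none = refl
  count-∅ {suc n} P? none with P? zero
  ... | yes p = ⊥-elim (none zero p)
  ... | no _ = count-∅ (P? ∘ suc) (none ∘ suc)

  count-all : ∀ {n ℓ} {P : Pred (Fin n) ℓ} (P? : Decidable P) → (∀ i → P i) → count P? ≡ n
  count-all {zero} P? all = refl
  count-all {suc n} P? all with P? zero
  ... | yes _ = cong suc (count-all (P? ∘ suc) (all ∘ suc))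
  ... | no ¬p = ⊥-elim (¬p (all zero))

  count-< : ∀ {n b} → b ≤ n → count (λ (i : Fin n) → toℕ i <? b) ≡ b
  count-< {n} {zero} _ = count-∅ {n} (λ i → toℕ i <? 0) (λ _ ())
  count-< {suc n} {suc b} (s≤s b≤n) = cong suc (count-< b≤n)

  count-> : ∀ {n} q → count (λ (i : Fin n) → q <? toℕ i) ≡ n ∸ suc q
  count-> {zero} q = refl
  count-> {suc n} zero = count-all {n} (λ i → 0 <? suc (toℕ i)) (λ _ → s≤s z≤n)
  count-> {suc n} (suc q) = count-> {n} q

  count-≟ : ∀ {n} (x : Fin n) → count (Fin._≟ x) ≡ 1
  count-≟ {suc n} zero = cong suc (count-∅ {n} (λ i → suc i Fin.≟ zero) (λ _ ()))
  count-≟ (suc x) = count-≟ x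

  count-interval : ∀ {n a b} → a ≤ b → b ≤ n →
    count (λ (i : Fin n) → (a ≤? toℕ i) ×-dec (toℕ i <? b)) ≡ b ∸ a
  count-interval {n} {a} {b} a≤b b≤n = begin
    count interval?
      ≡⟨ m+n∸m≡n a _ ⟨
    a + count interval? ∸ a
      ≡⟨ cong (λ x → x + count interval? ∸ a) (count-< (≤-trans a≤b b≤n)) ⟨
    count below-a? + count interval? ∸ a
      ≡⟨ cong (_∸ a) (count-∪ below-a? interval? (λ i<a (a≤i , _) → <⇒≱ i<a a≤i)) ⟨
    count (below-a? ∪? interval?) ∸ a
      ≡⟨ cong (_∸ a) (count-cong (below-a? ∪? interval?) below-b? split⁻¹ split) ⟩
    count below-b? ∸ a
      ≡⟨ cong (_∸ a) (count-< b≤n) ⟩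
    b ∸ a ∎
    where
    open ≡-Reasoning
    below-a? = λ (i : Fin n) → toℕ i <? a
    below-b? = λ (i : Fin n) → toℕ i <? b
    interval? = λ (i : Fin n) → (a ≤? toℕ i) ×-dec (toℕ i <? b)
    split : ∀ {i} → toℕ i < b → toℕ i < a ⊎ (a ≤ toℕ i × toℕ i < b)
    split {i} i<b with toℕ i <? a
    ... | yes i<a = inj₁ i<a
    ... | no i≮a = inj₂ (≮⇒≥ i≮a , i<b)
    split⁻¹ : ∀ {i} → toℕ i < a ⊎ (a ≤ toℕ i × toℕ i < b) → toℕ i < b
    split⁻¹ (inj₁ i<a) = <-≤-trans i<a a≤b
    split⁻¹ (inj₂ (_ , i<b)) = i<b

open Counting

module OutsideCorner {p q a b : ℕ} (a≤p : a ≤ p) (b≤q : b ≤ q) where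
  open ≡-Reasoning

  shiftBelow : Fin (p ∸ a) → Fin p
  shiftBelow w = fromℕ< (subst (a + toℕ w <_) (m+[n∸m]≡n a≤p) (+-monoʳ-< a (Fin.toℕ<n w)))

  upperBlock : Fin (a * q) → Fin p × Fin q
  upperBlock = map₁ (λ i → inject≤ i a≤p) ∘ remQuot q

  lowerBlock : Fin ((p ∸ a) * b) → Fin p × Fin q
  lowerBlock = map shiftBelow (λ j → inject≤ j b≤q) ∘ remQuot b

  enumerate : Fin (a * q + (p ∸ a) * b) → Fin p × Fin q
  enumerate = [ upperBlock , lowerBlock ]′ ∘ splitAt (a * q)

  enumerate-covers : ∀ i j → (a ≤ toℕ i × b ≤ toℕ j) ⊎ ∃[ y ] enumerate y ≡ (i , j)
  enumerate-covers i j with toℕ i <? a | toℕ j <? b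
  ... | yes i<a | _ = inj₂ (combine u j ↑ˡ (p ∸ a) * b , hit)
    where
    u = fromℕ< i<a
    hit : enumerate (combine u j ↑ˡ (p ∸ a) * b) ≡ (i , j)
    hit = begin
      [ upperBlock , lowerBlock ]′ (splitAt (a * q) (combine u j ↑ˡ (p ∸ a) * b))
        ≡⟨ cong [ upperBlock , lowerBlock ]′ (Fin.splitAt-↑ˡ (a * q) (combine u j) ((p ∸ a) * b)) ⟩
      map₁ (λ i → inject≤ i a≤p) (remQuot q (combine u j))
        ≡⟨ cong (map₁ (λ i → inject≤ i a≤p)) (Fin.remQuot-combine u j) ⟩
      (inject≤ u a≤p , j)
        ≡⟨ cong (_, j) (Fin.toℕ-injective (trans (Fin.toℕ-inject≤ u a≤p) (Fin.toℕ-fromℕ< i<a))) ⟩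
      (i , j) ∎
  ... | no i≮a | yes j<b = inj₂ ((a * q) ↑ʳ combine w v , hit)
    where
    a≤i = ≮⇒≥ i≮a
    i∸a<p∸a : toℕ i ∸ a < p ∸ a
    i∸a<p∸a = ∸-monoˡ-< (Fin.toℕ<n i) a≤i
    w = fromℕ< i∸a<p∸a
    v = fromℕ< j<b
    hit : enumerate ((a * q) ↑ʳ combine w v) ≡ (i , j)
    hit = begin
      [ upperBlock , lowerBlock ]′ (splitAt (a * q) ((a * q) ↑ʳ combine w v))
        ≡⟨ cong [ upperBlock , lowerBlock ]′ (Fin.splitAt-↑ʳ (a * q) ((p ∸ a) * b) (combine w v)) ⟩
      map shiftBelow (λ j → inject≤ j b≤q) (remQuot b (combine w v))
        ≡⟨ cong (map shiftBelow (λ j → inject≤ j b≤q)) (Fin.remQuot-combine w v) ⟩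
      (shiftBelow w , inject≤ v b≤q)
        ≡⟨ cong₂ _,_ (Fin.toℕ-injective (trans (Fin.toℕ-fromℕ< _)
                       (trans (cong (a +_) (Fin.toℕ-fromℕ< i∸a<p∸a)) (m+[n∸m]≡n a≤i))))
                     (Fin.toℕ-injective (trans (Fin.toℕ-inject≤ v b≤q) (Fin.toℕ-fromℕ< j<b))) ⟩
      (i , j) ∎
  ... | no i≮a | no j≮b = inj₁ (≮⇒≥ i≮a , ≮⇒≥ j≮b)

increasing₃ : ∀ {n} {x y z : Fin n} → x Fin.< y → y Fin.< z → StrictlyIncreasing (x ∷ y ∷ z ∷ [])
increasing₃ x<y y<z zero (suc zero) _ = x<y
increasing₃ x<y y<z zero (suc (suc zero)) _ = <-trans x<y y<z
increasing₃ x<y y<z (suc zero) (suc (suc zero)) _ = y<z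
increasing₃ x<y y<z zero zero ()
increasing₃ x<y y<z (suc zero) zero ()
increasing₃ x<y y<z (suc zero) (suc zero) (s≤s ())
increasing₃ x<y y<z (suc (suc zero)) zero ()
increasing₃ x<y y<z (suc (suc zero)) (suc zero) (s≤s ())
increasing₃ x<y y<z (suc (suc zero)) (suc (suc zero)) (s≤s (s≤s ()))

increasing⇒injective : ∀ {n} (f : Fin 3 → Fin n) → StrictlyIncreasing f → ∀ {i j} → f i ≡ f j → i ≡ j
increasing⇒injective f increasing {i} {j} fi≡fj with <-cmp (toℕ i) (toℕ j)
... | tri< i<j _ _ = ⊥-elim (<-irrefl (cong toℕ fi≡fj) (increasing i j i<j))
... | tri≈ _ i≡j _ = Fin.toℕ-injective i≡j
... | tri> _ _ j<i = ⊥-elim (<-irrefl (cong toℕ (sym fi≡fj)) (increasing j i j<i))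

increasing⇒contains123 : ∀ {n} (σ : Permutation′ n) (rows columns : Fin 3 → Fin n) →
  (∀ i → σ ⟨$⟩ʳ rows i ≡ columns i) → StrictlyIncreasing rows → StrictlyIncreasing columns →
  Contains123 (permMatrix σ)
increasing⇒contains123 σ rows columns images rows↑ columns↑ =
  rows , columns , rows↑ , columns↑ , identity
  where
  identity : ∀ i j → permMatrix σ (rows i) (columns j) ≡ I₃ i j
  identity i j rewrite images i = cong (λ b → if b then _ else _) (same-decision (i Fin.≟ j))
    where
    same-decision : Dec (i ≡ j) → does (columns i Fin.≟ columns j) ≡ does (i Fin.≟ j)
    same-decision (yes refl) =
      trans (dec-true (columns i Fin.≟ columns i) refl) (sym (dec-true (i Fin.≟ i) refl))
    same-decision (no i≢j) =
      trans (dec-false (columns i Fin.≟ columns j) (i≢j ∘ increasing⇒injective columns columns↑))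
            (sym (dec-false (i Fin.≟ j) i≢j))

pattern123⇒contains123 : ∀ {n} (σ : Permutation′ n) {a b c : Fin n} → a Fin.< b → b Fin.< c →
  σ ⟨$⟩ʳ a Fin.< σ ⟨$⟩ʳ b → σ ⟨$⟩ʳ b Fin.< σ ⟨$⟩ʳ c → Contains123 (permMatrix σ)
pattern123⇒contains123 σ {a} {b} {c} a<b b<c σa<σb σb<σc =
  increasing⇒contains123 σ (a ∷ b ∷ c ∷ []) ((σ ⟨$⟩ʳ a) ∷ (σ ⟨$⟩ʳ b) ∷ (σ ⟨$⟩ʳ c) ∷ [])
    (λ { zero → refl ; (suc zero) → refl ; (suc (suc zero)) → refl })
    (increasing₃ a<b b<c) (increasing₃ σa<σb σb<σc)

-- Columns are 0-indexed: these are the paper's columns m-t, …, m, the only ones B_n(m,t) meets.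
FlagColumn : ℕ → ℕ → ℕ → Set
FlagColumn m t j = m ∸ suc t ≤ j × j < m

flagColumn? : ∀ m t j → Dec (FlagColumn m t j)
flagColumn? m t j = (m ∸ suc t ≤? j) ×-dec (j <? m)

flagColumn⇒inB : ∀ {n m t} → t < m → m ≤ n → ∀ {r c : Fin n} →
  FlagColumn m t (toℕ c) → toℕ r ≤ n ∸ m → T (inB n m t r c)
flagColumn⇒inB {n} {m} {t} t<m m≤n {r} {c} (start≤c , c<m) upper with suc (toℕ c) ≟ m
... | yes lastColumn = Equivalence.from T-∨ (inj₁ (Equivalence.from T-∧
        (≡⇒≡ᵇ _ _ lastColumn , ≤⇒≤ᵇ (<-≤-trans (s≤s upper) (∸-monoʳ-< t<m m≤n)))))
... | no notLast = Equivalence.from T-∨ (inj₂ (Equivalence.from (T-∧ {suc (toℕ r) ≤ᵇ n + 1 ∸ m})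
        (≤⇒≤ᵇ rowBound , Equivalence.from T-∧ (≤⇒≤ᵇ startBound , ≤⇒≤ᵇ endBound))))
  where
  rowBound : suc (toℕ r) ≤ n + 1 ∸ m
  rowBound = subst (suc (toℕ r) ≤_) (sym (trans (+-∸-comm 1 m≤n) (+-comm (n ∸ m) 1))) (s≤s upper)
  startBound : m ∸ t ≤ suc (toℕ c)
  startBound = subst (_≤ suc (toℕ c)) (sym (+-∸-assoc 1 t<m)) (s≤s start≤c)
  endBound : suc (toℕ c) ≤ m ∸ 1
  endBound = pred-mono-≤ (≤∧≢⇒< c<m notLast)

hitsB≡count : ∀ n m t (σ : Permutation′ n) →
  hitsB n m t σ ≡ count (λ r → T? (inB n m t r (σ ⟨$⟩ʳ r)))
hitsB≡count n m t σ = trans (cong List.sum (map-tabulate id hit)) (listSum-tabulate hit)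
  where
  hit : Fin n → ℕ
  hit r = if inB n m t r (σ ⟨$⟩ʳ r) then 1 else 0

module SouthEastCorner {n m t : ℕ} (m≤n : m ≤ n) (t<m : t < m)
  (σ : Permutation′ n) (avoids : Avoids123 σ) (hitsOnce : hitsB n m t σ ≡ 1) where

  column : Fin n → ℕ
  column r = toℕ (σ ⟨$⟩ʳ r)

  flagStart : ℕ
  flagStart = m ∸ suc t

  Hit FlagRow Missed : Pred (Fin n) 0ℓ
  Hit r = T (inB n m t r (σ ⟨$⟩ʳ r))
  FlagRow r = FlagColumn m t (column r)
  Missed r = FlagRow r × ¬ Hit r

  hit? : Decidable Hit
  hit? r = T? (inB n m t r (σ ⟨$⟩ʳ r))
  flagRow? : Decidable FlagRow
  flagRow? r = flagColumn? m t (column r)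
  missed? : Decidable Missed
  missed? r = flagRow? r ×-dec ¬? (hit? r)

  missed⇒lower : ∀ {r} → Missed r → n ∸ m < toℕ r
  missed⇒lower (flag , ¬hit) = ≰⇒> (λ upper → ¬hit (flagColumn⇒inB t<m m≤n flag upper))

  t≤count-missed : t ≤ count missed?
  t≤count-missed = s≤s⁻¹ (begin
    suc t
      ≡⟨ m∸[m∸n]≡n t<m ⟨
    m ∸ flagStart
      ≡⟨ count-interval (m∸n≤m m (suc t)) m≤n ⟨
    count (λ (c : Fin n) → flagColumn? m t (toℕ c))
      ≡⟨ count-permute (λ (c : Fin n) → flagColumn? m t (toℕ c)) σ ⟨
    count flagRow?
      ≤⟨ count-mono flagRow? (hit? ∪? missed?) hitOrMissed ⟩
    count (hit? ∪? missed?)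
      ≡⟨ count-∪ hit? missed? (λ hit (_ , ¬hit) → ¬hit hit) ⟩
    count hit? + count missed?
      ≡⟨ cong (_+ count missed?) (trans (sym (hitsB≡count n m t σ)) hitsOnce) ⟩
    suc (count missed?) ∎)
    where
    open ≤-Reasoning
    hitOrMissed : ∀ {r} → FlagRow r → Hit r ⊎ Missed r
    hitOrMissed {r} flag with hit? r
    ... | yes hit = inj₁ hit
    ... | no ¬hit = inj₂ (flag , ¬hit)

  module _ (R : Fin n) (R-bottom : n ∸ t ≤ toℕ R) (R-east : m ≤ column R) where

    -- A missed flag 1 above row R would form a 123 pattern with the 1s in rows a and R, so the
    -- at least t missed ones all lie below R, where fewer than t rows are left.
    upperWestRow⇒⊥ : (a : Fin n) → toℕ a ≤ n ∸ m → column a < flagStart → ⊥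
    upperWestRow⇒⊥ a a-upper a-west = <-irrefl refl (≤-trans sucR≤n∸t R-bottom)
      where
      missed⇒belowR : ∀ {r} → Missed r → toℕ R < toℕ r
      missed⇒belowR {r} missed@((start≤r , r<m) , _) with <-cmp (toℕ r) (toℕ R)
      ... | tri< r<R _ _ = ⊥-elim (avoids (pattern123⇒contains123 σ
            (≤-<-trans a-upper (missed⇒lower missed)) r<R (<-≤-trans a-west start≤r) (<-≤-trans r<m R-east)))
      ... | tri≈ _ r≡R _ =
            ⊥-elim (<⇒≱ r<m (subst (λ x → m ≤ column x) (sym (Fin.toℕ-injective r≡R)) R-east))
      ... | tri> _ _ R<r = R<r
      t≤n∸sucR : t ≤ n ∸ suc (toℕ R)
      t≤n∸sucR = ≤-trans t≤count-missed
        (subst (count missed? ≤_) (count-> {n} (toℕ R))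
               (count-mono missed? (λ r → toℕ R <? toℕ r) missed⇒belowR))
      sucR≤n∸t : suc (toℕ R) ≤ n ∸ t
      sucR≤n∸t = m+n≤o⇒m≤o∸n (suc (toℕ R))
        (subst (_≤ n) (+-comm t (suc (toℕ R))) (m≤o∸n⇒m+n≤o t (Fin.toℕ<n R) t≤n∸sucR))

    -- The flagStart ones west of the flag, the at least t missed ones and the one in row R would be
    -- m ones in the last m-1 rows.
    noUpperWestRow⇒⊥ : (∀ a → toℕ a ≤ n ∸ m → ¬ column a < flagStart) → ⊥
    noUpperWestRow⇒⊥ noUpperWest =
      <-irrefl refl (subst (_≤ n) m+suc[n∸m]≡suc[n] (m≤o∸n⇒m+n≤o m suc[n∸m]≤n m≤n∸suc[n∸m]))
      where
      west? = λ r → column r <? flagStart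
      isR? = λ r → r Fin.≟ R
      lower? = λ (r : Fin n) → n ∸ m <? toℕ r
      suc[n∸m]≤n : suc (n ∸ m) ≤ n
      suc[n∸m]≤n = ∸-monoʳ-< (≤-<-trans z≤n t<m) m≤n
      m+suc[n∸m]≡suc[n] : m + suc (n ∸ m) ≡ suc n
      m+suc[n∸m]≡suc[n] = trans (+-suc m (n ∸ m)) (cong suc (m+[n∸m]≡n m≤n))
      inLower : ∀ {r} → (column r < flagStart ⊎ Missed r) ⊎ r ≡ R → n ∸ m < toℕ r
      inLower {r} (inj₁ (inj₁ west)) = ≰⇒> (λ upper → noUpperWest r upper west)
      inLower (inj₁ (inj₂ missed)) = missed⇒lower missed
      inLower (inj₂ refl) = <-≤-trans (∸-monoʳ-< t<m m≤n) R-bottom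
      westOrMissed≢R : ∀ {r} → column r < flagStart ⊎ Missed r → r ≢ R
      westOrMissed≢R (inj₁ west) refl = <⇒≱ (<-≤-trans west (m∸n≤m m (suc t))) R-east
      westOrMissed≢R (inj₂ ((_ , R<m) , _)) refl = <⇒≱ R<m R-east
      m≤n∸suc[n∸m] : m ≤ n ∸ suc (n ∸ m)
      m≤n∸suc[n∸m] = begin
        m
          ≡⟨ m∸n+n≡m t<m ⟨
        flagStart + suc t
          ≤⟨ +-monoʳ-≤ flagStart (subst (suc t ≤_) (+-comm 1 _) (s≤s t≤count-missed)) ⟩
        flagStart + (count missed? + 1)
          ≡⟨ +-assoc flagStart (count missed?) 1 ⟨
        flagStart + count missed? + 1
          ≡⟨ cong₂ (λ x y → x + count missed? + y) count-west (count-≟ R) ⟨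
        count west? + count missed? + count isR?
          ≡⟨ cong (_+ count isR?) (count-∪ west? missed? λ west ((start≤r , _) , _) → <⇒≱ west start≤r) ⟨
        count (west? ∪? missed?) + count isR?
          ≡⟨ count-∪ (west? ∪? missed?) isR? westOrMissed≢R ⟨
        count ((west? ∪? missed?) ∪? isR?)
          ≤⟨ count-mono ((west? ∪? missed?) ∪? isR?) lower? inLower ⟩
        count lower?
          ≡⟨ count-> {n} (n ∸ m) ⟩
        n ∸ suc (n ∸ m) ∎
        where
        open ≤-Reasoning
        count-west : count west? ≡ flagStart
        count-west = trans (count-permute (λ c → toℕ c <? flagStart) σ)
                           (count-< (≤-trans (m∸n≤m m (suc t)) m≤n))

  southEastCorner-empty : ∀ R → n ∸ t ≤ toℕ R → column R < m
  southEastCorner-empty R R-bottom with Fin.any? (λ a → (toℕ a ≤? n ∸ m) ×-dec (column a <? flagStart))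
  ... | yes (a , a-upper , a-west) = ≰⇒> λ R-east → upperWestRow⇒⊥ R R-bottom R-east a a-upper a-west
  ... | no none = ≰⇒> λ R-east →
          noUpperWestRow⇒⊥ R R-bottom R-east (λ a a-upper a-west → none (a , a-upper , a-west))

open Independence using (independent⇒≤; independent-restrict)
open PermutationMatrices using (lineSumAndBlock; independent-lineSumAndBlock; permMatrix-zero)

lineSumAndBlock-southEast : ∀ {n m t} → suc m ≤ suc n → t < suc m →
  (σ : Permutation′ (suc n)) → Avoids123 σ → hitsB (suc n) (suc m) t σ ≡ 1 →
  ∀ {i j} → n ∸ t ≤ toℕ i → m ≤ toℕ j → lineSumAndBlock σ (just (i , j)) ≡ 0ℚ
lineSumAndBlock-southEast {n} {m} {t} m≤n t<m σ avoids hitsOnce {i} {j} bottom east =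
  permMatrix-zero σ λ σi≡j →
    <⇒≱ (southEastCorner-empty (suc i) bottom′) (subst (suc m ≤_) (cong toℕ (sym σi≡j)) (s≤s east))
  where
  open SouthEastCorner m≤n t<m σ avoids hitsOnce
  bottom′ : suc n ∸ t ≤ toℕ (suc i)
  bottom′ = subst (_≤ suc (toℕ i)) (sym (+-∸-assoc 1 (≤-trans (s≤s⁻¹ t<m) (s≤s⁻¹ m≤n)))) (s≤s bottom)

cornerComplement-size : ∀ {n m t} → t ≤ n → m ≤ n →
  suc ((n ∸ t) * n + (n ∸ (n ∸ t)) * m) + t * (n ∸ m) ≡ n ^ 2 + 1
cornerComplement-size {n} {m} {t} t≤n m≤n = begin
  suc ((n ∸ t) * n + (n ∸ (n ∸ t)) * m) + t * (n ∸ m)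
    ≡⟨ cong (λ x → suc ((n ∸ t) * n + x * m) + t * (n ∸ m)) (m∸[m∸n]≡n t≤n) ⟩
  suc ((n ∸ t) * n + t * m) + t * (n ∸ m)   ≡⟨ regroup (n ∸ t) t n m (n ∸ m) ⟩
  suc ((n ∸ t) * n + t * (m + (n ∸ m)))     ≡⟨ cong (λ x → suc ((n ∸ t) * n + t * x)) (m+[n∸m]≡n m≤n) ⟩
  suc ((n ∸ t) * n + t * n)                 ≡⟨ cong suc (*-distribʳ-+ n (n ∸ t) t) ⟨
  suc ((n ∸ t + t) * n)                     ≡⟨ cong (λ x → suc (x * n)) (m∸n+n≡m t≤n) ⟩
  suc (n * n)                               ≡⟨ square n ⟩
  n ^ 2 + 1                                 ∎
  where
  open ≡-Reasoning
  regroup : ∀ a t n m d → suc (a * n + t * m) + t * d ≡ suc (a * n + t * (m + d))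
  regroup = solve-∀
  square : ∀ n → suc (n * n) ≡ n * (n * 1) + 1
  square = solve-∀

theorem4p4 : (n m t : ℕ) → 1 ≤ n → 1 ≤ m → m ≤ n → t < m →
    (k : ℕ) (σ : Fin k → Permutation′ n) →
    (∀ l → Avoids123 (σ l)) →
    (∀ l → hitsB n m t (σ l) ≡ 1) →
    LinearlyIndependent (λ l → permMatrix (σ l)) →
    k + t * (n ∸ m) ≤ (n ∸ 1) ^ 2 + 1
theorem4p4 n zero t _ () _ _ _ _ _ _ _
theorem4p4 zero (suc m) t _ _ () _ _ _ _ _ _
theorem4p4 (suc n) (suc m) t _ _ m≤n t<m k σ avoids hitsOnce independent =
  ≤-trans (+-monoˡ-≤ (t * (n ∸ m)) k≤suc[d]) (≤-reflexive (cornerComplement-size t≤n (s≤s⁻¹ m≤n)))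
  where
  t≤n : t ≤ n
  t≤n = ≤-trans (s≤s⁻¹ t<m) (s≤s⁻¹ m≤n)
  open OutsideCorner (m∸n≤m n t) (s≤s⁻¹ m≤n)
  d : ℕ
  d = (n ∸ t) * n + (n ∸ (n ∸ t)) * m
  coordinate : Fin (suc d) → Maybe (Fin n × Fin n)
  coordinate zero = nothing
  coordinate (suc y) = just (enumerate y)
  covers : ∀ x → (∀ l → lineSumAndBlock (σ l) x ≡ 0ℚ) ⊎ ∃[ y ] coordinate y ≡ x
  covers nothing = inj₂ (zero , refl)
  covers (just (i , j)) with enumerate-covers i j
  ... | inj₁ (bottom , east) =
          inj₁ λ l → lineSumAndBlock-southEast m≤n t<m (σ l) (avoids l) (hitsOnce l) bottom east
  ... | inj₂ (y , enumerate-y≡ij) = inj₂ (suc y , cong just enumerate-y≡ij)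
  k≤suc[d] : k ≤ suc d
  k≤suc[d] = independent⇒≤ _
    (independent-restrict _ coordinate covers (independent-lineSumAndBlock σ independent))
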